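{- Let $D$ be a finite directed graph and let $S \subseteq V(D)$ be a set of vertices. Then \[ \max \{|S \cap V(\mathcal{C})| \colon \mathcal{C} \text{ a collection of vertex-disjoint (directed) cycles in } D \} \;\ge\;\min \{|X| \colon X \subseteq V(D) \text{ hits all $S$-cycles in } D\}. \]
   Context: Cycles are directed cycles. An $S$-cycle is a directed cycle of $D$ containing at least one vertex of $S$. $V(\mathcal{C})$ denotes the set of all vertices lying on some cycle of $\mathcal{C}$. A vertex set $X$ hits a cycle if the cycle contains a vertex of $X$. -}

module Defs where

open import Data.Nat using (ℕ)
open import Data.Bool using (Bool; true; false)
open import Data.Fin using (Fin)
import Data.Fin as Fin
open import Data.Fin.Subset using (Subset; _∩_; ∣_∣) renaming (_∈_ to _∈ₛ_)
open import Data.List using (List; []; _∷_; _++_; [_]; concat)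
open import Data.List.Relation.Unary.All using (All)
open import Data.List.Relation.Unary.Any using (Any)
open import Data.List.Relation.Unary.AllPairs using (AllPairs)
open import Data.List.Relation.Unary.Unique.Propositional using (Unique)
open import Data.List.Membership.Propositional using (_∈_)
import Data.List.Membership.DecPropositional as DecMem
open import Data.Vec using (tabulate)
open import Data.Product using (_×_)
open import Data.Empty using (⊥)
open import Data.Unit using (⊤)
open import Relation.Nullary using (does)
open import Relation.Binary.PropositionalEquality using (_≡_)

-- A finite directed graph on the vertex set Fin n, given by its adjacency
-- relation (loops allowed; parallel arcs are irrelevant for cycles as vertex sequences).
Digraph : ℕ → Set
Digraph n = Fin n → Fin n → Bool

Arc : ∀ {n} → Digraph n → Fin n → Fin n → Set
Arc D u v = D u v ≡ true

Walk : ∀ {n} → Digraph n → List (Fin n) → Set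
Walk D [] = ⊤
Walk D (u ∷ []) = ⊤
Walk D (u ∷ v ∷ vs) = Arc D u v × Walk D (v ∷ vs)

IsCycle : ∀ {n} → Digraph n → List (Fin n) → Set
IsCycle D [] = ⊥
IsCycle D (v ∷ vs) = Unique (v ∷ vs) × Walk D ((v ∷ vs) ++ [ v ])

Disjoint : ∀ {n} → List (Fin n) → List (Fin n) → Set
Disjoint c d = ∀ {v} → v ∈ c → v ∈ d → ⊥

IsDisjointCycles : ∀ {n} → Digraph n → List (List (Fin n)) → Set
IsDisjointCycles D 𝒞 = All (IsCycle D) 𝒞 × AllPairs Disjoint 𝒞

V : ∀ {n} → List (List (Fin n)) → Subset n
V {n} 𝒞 = tabulate (λ v → does (v ∈? concat 𝒞))
  where open DecMem (Fin._≟_ {n}) using (_∈?_)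

Hits : ∀ {n} → Subset n → List (Fin n) → Set
Hits X c = Any (_∈ₛ X) c

HitsAllSCycles : ∀ {n} → Digraph n → Subset n → Subset n → Set
HitsAllSCycles D S X = ∀ c → IsCycle D c → Hits S c → Hits X c

-- A collection of vertex-disjoint cycles amounts to a permutation σ of V(D) that moves every
-- vertex along an arc or fixes it. Give the pair x ↦ y weight 1 when x ∈ S and xy is an arc,
-- and 0 otherwise. Egerváry's theorem for this assignment problem, proved by adding the rows
-- of S one at a time and repairing each addition with one phase of the Hungarian method,
-- yields such a σ together with integral potentials p, q such that p x + q y bounds the weight
-- of every allowed pair x ↦ y, with equality along σ.
-- Let X be the set of vertices with p x + q x > 0. Since p x + q x ≥ 0 everywhere,
-- |X| ≤ Σ (p x + q x) = Σ (p x + q (σ x)), the number of vertices of S that σ moves along an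
-- arc, all of which lie on cycles of σ. At a vertex outside X we have p = -q, so q does not
-- decrease along an arc leaving it, and increases if the vertex is in S: an S-cycle avoiding X
-- would make q increase strictly around a cycle.

{-# OPTIONS --safe #-}
module Submission where

open import Defs
open import Data.Nat using (ℕ; zero; suc; _≤_; _<_; z≤n)
import Data.Nat as ℕ
import Data.Nat.Properties as ℕ
open import Data.Nat.Induction using (<-wellFounded)
open import Induction.WellFounded using (Acc; acc)
open import Data.Integer using (ℤ; +_; +≤+; 0ℤ; 1ℤ; pred; _+_; _<?_) renaming (suc to sucℤ; _≤_ to _≤ᶻ_; _<_ to _<ᶻ_)
import Data.Integer.Properties as ℤ
open import Algebra.Properties.CommutativeSemigroup ℤ.+-commutativeSemigroup using (x∙yz≈y∙xz; xy∙z≈xz∙y)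
open import Algebra.Properties.CommutativeMonoid.Sum ℤ.+-0-commutativeMonoid using (sum; ∑-distrib-+; ∑-permute; sum-cong-≗)
open import Data.Bool using (Bool; true; false; if_then_else_; _∧_)
import Data.Bool as Bool
open import Data.Fin using (Fin; toℕ; _≟_)
import Data.Fin as Fin
open import Data.Fin.Properties using (pigeonhole; any?)
open import Data.Fin.Subset using (Subset; _∩_; ∣_∣; _∪_; ⁅_⁆; _⊂_; _⊃_; _⊆_) renaming (_∈_ to _∈ₛ_; _∉_ to _∉ₛ_)
open import Data.Fin.Subset.Properties using (x∈⁅x⁆; x∈⁅y⁆⇒x≡y; x∈p∪q⁺; x∈p∪q⁻; p⊆p∪q; x∈p∩q⁺; p⊆q⇒∣p∣≤∣q∣) renaming (_∈?_ to _∈ₛ?_)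
open import Data.Fin.Subset.Induction using (⊃-wellFounded)
open import Data.Fin.Permutation using (Permutation′; _⟨$⟩ʳ_; _⟨$⟩ˡ_; inverseˡ; inverseʳ; transpose; _∘ₚ_; id)
open import Data.Vec using (tabulate; lookup)
open import Data.Vec.Properties using (lookup∘tabulate; []=⇒lookup; lookup⇒[]=)
open import Data.List using (List; []; _∷_; _++_; [_]; applyUpTo; concat; map; filter; allFin)
open import Data.List.Relation.Unary.All using (All; []; _∷_)
import Data.List.Relation.Unary.All as All
import Data.List.Relation.Unary.All.Properties as All
open import Data.List.Relation.Unary.Any using (Any; here; there)
import Data.List.Relation.Unary.Any as Any
open import Data.List.Relation.Unary.AllPairs using (AllPairs; []; _∷_)
import Data.List.Relation.Unary.AllPairs.Properties as AllPairs
open import Data.List.Relation.Unary.Unique.Propositional using (Unique)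
open import Data.List.Membership.Propositional using (_∈_; _∉_)
open import Data.List.Membership.Propositional.Properties using (∈-applyUpTo⁻; ∈-applyUpTo⁺; ∈-++⁺ˡ; ∈-++⁺ʳ; ∈-concat⁺′; ∈-map⁺; ∈-filter⁺; ∈-filter⁻; ∈-allFin)
import Data.List.Membership.DecPropositional as DecMembership
open import Data.Product using (Σ; ∃; _×_; _,_; proj₁; proj₂)
open import Data.Sum using (_⊎_; inj₁; inj₂)
open import Data.Unit using (tt)
open import Function using (Injection; _∘_; mk⇔)
open import Function.Properties.Inverse using (Inverse⇒Injection)
open import Relation.Nullary using (¬_; Dec; yes; no; does; contradiction)
open import Relation.Nullary.Decidable using (_×-dec_; _⊎-dec_; ¬?; dec-true; dec-false; decidable-stable; does-⇔; T?)
open import Relation.Unary using (Pred; Decidable)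
open import Relation.Binary.PropositionalEquality using (_≡_; _≢_; refl; sym; trans; cong; cong₂; cong-app; subst; subst₂; module ≡-Reasoning)

least-witness : ∀ {p} {P : Pred ℕ p} → Decidable P → ∀ m → P m →
                ∃ λ k → P k × (∀ {j} → j < k → ¬ P j)
least-witness {P = P} P? m = go m (<-wellFounded m)
  where
  go : ∀ m → Acc _<_ m → P m → ∃ λ k → P k × (∀ {j} → j < k → ¬ P j)
  go m (acc smaller) Pm with ℕ.anyUpTo? P? m
  ... | yes (j , j<m , Pj) = go j (smaller j<m) Pj
  ... | no none = m , Pm , λ j<m Pj → none (_ , j<m , Pj)

<⇒∃+suc : ∀ {i j} → i < j → ∃ λ k → i ℕ.+ suc k ≡ j
<⇒∃+suc {i} i<j with ℕ.m≤n⇒∃[o]m+o≡n i<j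
... | k , 1+i+k≡j = k , trans (ℕ.+-suc i k) 1+i+k≡j

⟨$⟩ʳ-injective : ∀ {n} (π : Permutation′ n) {x y} → π ⟨$⟩ʳ x ≡ π ⟨$⟩ʳ y → x ≡ y
⟨$⟩ʳ-injective π = Injection.injective (Inverse⇒Injection π)

transpose-matchˡ : ∀ {n} (i j : Fin n) → transpose i j ⟨$⟩ʳ i ≡ j
transpose-matchˡ i j rewrite dec-true (i ≟ i) refl = refl

transpose-matchʳ : ∀ {n} (i j : Fin n) → transpose i j ⟨$⟩ʳ j ≡ i
transpose-matchʳ i j with j ≟ i
... | yes j≡i = j≡i
... | no _ rewrite dec-true (j ≟ j) refl = refl

transpose-other : ∀ {n} {i j k : Fin n} → k ≢ i → k ≢ j → transpose i j ⟨$⟩ʳ k ≡ k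
transpose-other {i = i} {j} {k} k≢i k≢j rewrite dec-false (k ≟ i) k≢i | dec-false (k ≟ j) k≢j = refl

x∉p∪⁅y⁆⁻ : ∀ {n} {p : Subset n} {x y} → x ∉ₛ p ∪ ⁅ y ⁆ → x ∉ₛ p × x ≢ y
x∉p∪⁅y⁆⁻ x∉ = (λ x∈p → x∉ (x∈p∪q⁺ (inj₁ x∈p))) , (λ { refl → x∉ (x∈p∪q⁺ (inj₂ (x∈⁅x⁆ _))) })

∈-tabulate⁺ : ∀ {n} {f : Fin n → Bool} {x} → f x ≡ true → x ∈ₛ tabulate f
∈-tabulate⁺ {f = f} {x} fx≡true = lookup⇒[]= x (tabulate f) (trans (lookup∘tabulate f x) fx≡true)

∈-tabulate⁻ : ∀ {n} {f : Fin n → Bool} {x} → x ∈ₛ tabulate f → f x ≡ true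
∈-tabulate⁻ {f = f} {x} x∈ = trans (sym (lookup∘tabulate f x)) ([]=⇒lookup x∈)

∈V⁺ : ∀ {n} {𝒞 : List (List (Fin n))} {x} → x ∈ concat 𝒞 → x ∈ₛ V 𝒞
∈V⁺ {n} {𝒞} {x} x∈ = ∈-tabulate⁺ (dec-true (x ∈? concat 𝒞) x∈)
  where open DecMembership (_≟_ {n}) using (_∈?_)

sucℤ-+ : ∀ a b → sucℤ a + b ≡ sucℤ (a + b)
sucℤ-+ a b = ℤ.+-assoc 1ℤ a b

pred-+-sucℤ : ∀ a b → pred a + sucℤ b ≡ a + b
pred-+-sucℤ a b = begin
  pred a + sucℤ b     ≡⟨ ℤ.pred-+ a (sucℤ b) ⟩
  pred (a + sucℤ b)   ≡⟨ cong pred (x∙yz≈y∙xz a 1ℤ b) ⟩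
  pred (sucℤ (a + b)) ≡⟨ ℤ.pred-suc (a + b) ⟩
  a + b               ∎
  where open ≡-Reasoning

indicator : Bool → ℤ
indicator b = if b then 1ℤ else 0ℤ

indicator≥0 : ∀ b → 0ℤ ≤ᶻ indicator b
indicator≥0 true = +≤+ z≤n
indicator≥0 false = ℤ.≤-refl

∣tabulate∣≡sum : ∀ {n} (f : Fin n → Bool) → + ∣ tabulate f ∣ ≡ sum (indicator ∘ f)
∣tabulate∣≡sum {zero} f = refl
∣tabulate∣≡sum {suc n} f with f Fin.zero
... | true = cong (_+_ 1ℤ) (∣tabulate∣≡sum (f ∘ Fin.suc))
... | false = trans (∣tabulate∣≡sum (f ∘ Fin.suc)) (sym (ℤ.+-identityˡ _))

sum-mono-≤ : ∀ {n} {f g : Fin n → ℤ} → (∀ i → f i ≤ᶻ g i) → sum f ≤ᶻ sum g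
sum-mono-≤ {zero} f≤g = ℤ.≤-refl
sum-mono-≤ {suc n} f≤g = ℤ.+-mono-≤ (f≤g Fin.zero) (sum-mono-≤ (f≤g ∘ Fin.suc))

positive : ∀ {n} → (Fin n → ℤ) → Subset n
positive f = tabulate (λ x → does (0ℤ <? f x))

∣positive∣≤sum : ∀ {n} (f : Fin n → ℤ) → (∀ x → 0ℤ ≤ᶻ f x) → + ∣ positive f ∣ ≤ᶻ sum f
∣positive∣≤sum f f≥0 =
  subst (_≤ᶻ sum f) (sym (∣tabulate∣≡sum (λ x → does (0ℤ <? f x)))) (sum-mono-≤ indicator≤f)
  where
  indicator≤f : ∀ x → indicator (does (0ℤ <? f x)) ≤ᶻ f x
  indicator≤f x with 0ℤ <? f x
  ... | yes 0<fx = ℤ.i<j⇒suc[i]≤j 0<fx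
  ... | no _ = f≥0 x

∉positive⇒≡0 : ∀ {n} {f : Fin n → ℤ} {x} → 0ℤ ≤ᶻ f x → x ∉ₛ positive f → f x ≡ 0ℤ
∉positive⇒≡0 {f = f} {x} 0≤fx x∉ =
  ℤ.≤-antisym (ℤ.≮⇒≥ λ 0<fx → x∉ (∈-tabulate⁺ (dec-true (0ℤ <? f x) 0<fx))) 0≤fx

walk-applyUpTo : ∀ {n} (D : Digraph n) (f : ℕ → Fin n) k →
                 (∀ i → Arc D (f i) (f (suc i))) →
                 Walk D (applyUpTo f (suc k) ++ [ f (suc k) ])
walk-applyUpTo D f zero arc = arc 0 , tt
walk-applyUpTo D f (suc k) arc = arc 0 , walk-applyUpTo D (f ∘ suc) k (arc ∘ suc)

module Orbits {n : ℕ} (σ : Permutation′ n) where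
  open import Function.Endo.Propositional (Fin n) using (_^_; ^-homo)
  open DecMembership (_≟_ {n}) using (_∈?_)

  σ^ : ℕ → Fin n → Fin n
  σ^ i = (σ ⟨$⟩ʳ_) ^ i

  σ^-+ : ∀ i j v → σ^ (i ℕ.+ j) v ≡ σ^ i (σ^ j v)
  σ^-+ i j v = cong-app (^-homo (σ ⟨$⟩ʳ_) i j) v

  σ^-injective : ∀ i {u v} → σ^ i u ≡ σ^ i v → u ≡ v
  σ^-injective zero u≡v = u≡v
  σ^-injective (suc i) σ^1+iu≡σ^1+iv = σ^-injective i (⟨$⟩ʳ-injective σ σ^1+iu≡σ^1+iv)

  σ^-repeat : ∀ {i j} v → i < j → σ^ i v ≡ σ^ j v → ∃ λ k → i ℕ.+ suc k ≡ j × σ^ (suc k) v ≡ v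
  σ^-repeat {i} {j} v i<j σ^iv≡σ^jv with <⇒∃+suc i<j
  ... | k , i+1+k≡j = k , i+1+k≡j , sym (σ^-injective i (begin
    σ^ i v                  ≡⟨ σ^iv≡σ^jv ⟩
    σ^ j v                  ≡⟨ cong (λ t → σ^ t v) i+1+k≡j ⟨
    σ^ (i ℕ.+ suc k) v      ≡⟨ σ^-+ i (suc k) v ⟩
    σ^ i (σ^ (suc k) v)     ∎))
    where open ≡-Reasoning

  σ^-returns : ∀ v → ∃ λ m → σ^ (suc m) v ≡ v
  σ^-returns v with pigeonhole (ℕ.n<1+n n) (λ (i : Fin (suc n)) → σ^ (toℕ i) v)
  ... | i , j , i<j , σ^iv≡σ^jv with σ^-repeat v i<j σ^iv≡σ^jv
  ...   | k , _ , σ^1+kv≡v = k , σ^1+kv≡v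

  record Orbit (v : Fin n) : Set where
    field
      last : ℕ
      closes : σ^ (suc last) v ≡ v
      minimal : ∀ {k} → k < last → σ^ (suc k) v ≢ v

    list : List (Fin n)
    list = applyUpTo (λ i → σ^ i v) (suc last)

  orbit : ∀ v → Orbit v
  orbit v with σ^-returns v
  ... | m , σ^1+mv≡v with least-witness (λ k → σ^ (suc k) v ≟ v) m σ^1+mv≡v
  ...   | k , closes , minimal = record { last = k ; closes = closes ; minimal = minimal }

  module _ {v : Fin n} (O : Orbit v) where
    open Orbit O

    orbit-unique : Unique list
    orbit-unique = AllPairs.applyUpTo⁺₁ (λ i → σ^ i v) (suc last) distinct
      where
      distinct : ∀ {i j} → i < j → j < suc last → σ^ i v ≢ σ^ j v
      distinct {i} {j} i<j j<1+last σ^iv≡σ^jv with σ^-repeat v i<j σ^iv≡σ^jv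
      ... | k , i+1+k≡j , σ^1+kv≡v = minimal k<last σ^1+kv≡v
        where
        k<last : k < last
        k<last = ℕ.≤-trans (ℕ.m≤n+m (suc k) i) (subst (ℕ._≤ last) (sym i+1+k≡j) (ℕ.≤-pred j<1+last))

    orbit-cycle : ∀ {D} → (∀ i → Arc D (σ^ i v) (σ^ (suc i) v)) → IsCycle D list
    orbit-cycle {D} arcs =
      orbit-unique , subst (λ t → Walk D (list ++ [ t ])) closes (walk-applyUpTo D (λ i → σ^ i v) last arcs)

    orbit-σ⁻¹ : ∀ {u} → u ∈ list → σ ⟨$⟩ˡ u ∈ list
    orbit-σ⁻¹ u∈ with ∈-applyUpTo⁻ (λ i → σ^ i v) u∈
    ... | zero , _ , refl = subst (_∈ list) σ^lastv≡σ⁻¹v (∈-applyUpTo⁺ (λ i → σ^ i v) (ℕ.n<1+n last))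
      where
      σ^lastv≡σ⁻¹v : σ^ last v ≡ σ ⟨$⟩ˡ v
      σ^lastv≡σ⁻¹v = trans (sym (inverseˡ σ)) (cong (σ ⟨$⟩ˡ_) closes)
    ... | suc i , 1+i<1+last , refl =
      subst (_∈ list) (sym (inverseˡ σ)) (∈-applyUpTo⁺ (λ i → σ^ i v) (ℕ.m≤n⇒m≤1+n (ℕ.≤-pred 1+i<1+last)))

  orbit-σ⁻ⁱ : ∀ {u v} (O : Orbit v) i → σ^ i u ∈ Orbit.list O → u ∈ Orbit.list O
  orbit-σ⁻ⁱ O zero u∈ = u∈
  orbit-σ⁻ⁱ O (suc i) σ^1+iu∈ = orbit-σ⁻ⁱ O i (subst (_∈ Orbit.list O) (inverseˡ σ) (orbit-σ⁻¹ O σ^1+iu∈))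

  orbit-disjoint : ∀ {u v} (O : Orbit u) (P : Orbit v) → u ∉ Orbit.list P →
                   Disjoint (Orbit.list O) (Orbit.list P)
  orbit-disjoint {u} O P u∉P x∈O x∈P with ∈-applyUpTo⁻ (λ i → σ^ i u) x∈O
  ... | i , _ , refl = u∉P (orbit-σ⁻ⁱ P i x∈P)

  orbitOf : Fin n → List (Fin n)
  orbitOf v = Orbit.list (orbit v)

  module _ {c} {C : Pred (Fin n) c} (C? : Decidable C) where

    record OrbitCover (L : List (Fin n)) : Set c where
      field
        roots : List (Fin n)
        roots-in-C : All C roots
        disjoint : AllPairs (λ u v → Disjoint (orbitOf u) (orbitOf v)) roots
        covers : ∀ {x} → x ∈ L → C x → x ∈ concat (map orbitOf roots)

    private
      keep : ∀ {x L} (O : OrbitCover L) → let open OrbitCover O in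
             (C x → x ∈ concat (map orbitOf roots)) → OrbitCover (x ∷ L)
      keep O covers-x = record { OrbitCover O ; covers = λ { (here refl) → covers-x ; (there x∈L) → covers x∈L } }
        where open OrbitCover O

      add : ∀ {x L} (O : OrbitCover L) → let open OrbitCover O in
            C x → x ∉ concat (map orbitOf roots) → OrbitCover (x ∷ L)
      add {x} O Cx x∉ = record
        { roots = x ∷ roots
        ; roots-in-C = Cx ∷ roots-in-C
        ; disjoint = All.tabulate apart ∷ disjoint
        ; covers = λ { (here refl) _ → ∈-++⁺ˡ {xs = orbitOf x} (here refl)
                     ; (there y∈L) Cy → ∈-++⁺ʳ (orbitOf x) (covers y∈L Cy) }
        }
        where
        open OrbitCover O
        apart : ∀ {v} → v ∈ roots → Disjoint (orbitOf x) (orbitOf v)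
        apart v∈ = orbit-disjoint (orbit x) (orbit _) (λ x∈ → x∉ (∈-concat⁺′ x∈ (∈-map⁺ orbitOf v∈)))

    orbitCover : ∀ L → OrbitCover L
    orbitCover [] = record { roots = [] ; roots-in-C = [] ; disjoint = [] ; covers = λ () }
    orbitCover (x ∷ L) with orbitCover L
    ... | O with C? x | x ∈? concat (map orbitOf (OrbitCover.roots O))
    ...   | yes Cx | no x∉ = add O Cx x∉
    ...   | yes _  | yes x∈ = keep O (λ _ → x∈)
    ...   | no ¬Cx | _ = keep O (λ Cx → contradiction Cx ¬Cx)

module _ {n : ℕ} (D : Digraph n) where

  ArcOrStay : Fin n → Fin n → Set
  ArcOrStay x y = Arc D x y ⊎ x ≡ y

  arcOrStay? : ∀ x y → Dec (ArcOrStay x y)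
  arcOrStay? x y = (D x y Bool.≟ true) ⊎-dec (x ≟ y)

  -- The cycles of such a σ are its nontrivial orbits and its fixed points that carry a loop.
  MovesAlong : Permutation′ n → Set
  MovesAlong σ = ∀ x → ArcOrStay x (σ ⟨$⟩ʳ x)

  record CycleDecomposition (σ : Permutation′ n) : Set where
    field
      𝒞 : List (List (Fin n))
      isDisjointCycles : IsDisjointCycles D 𝒞
      covers : ∀ x → Arc D x (σ ⟨$⟩ʳ x) → x ∈ concat 𝒞

  module _ {σ : Permutation′ n} (along : MovesAlong σ) where
    open Orbits σ

    arc-σ : ∀ {x} → Arc D x (σ ⟨$⟩ʳ x) → Arc D (σ ⟨$⟩ʳ x) (σ ⟨$⟩ʳ (σ ⟨$⟩ʳ x))
    arc-σ {x} a with along (σ ⟨$⟩ʳ x)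
    ... | inj₁ a′ = a′
    ... | inj₂ σx≡σσx = subst (λ y → Arc D y (σ ⟨$⟩ʳ y)) (σ^-injective 1 σx≡σσx) a

    arc-σ^ : ∀ {x} → Arc D x (σ ⟨$⟩ʳ x) → ∀ i → Arc D (σ^ i x) (σ^ (suc i) x)
    arc-σ^ a zero = a
    arc-σ^ a (suc i) = arc-σ (arc-σ^ a i)

    moved? : ∀ x → Dec (Arc D x (σ ⟨$⟩ʳ x))
    moved? x = D x (σ ⟨$⟩ʳ x) Bool.≟ true

    disjointCycles : CycleDecomposition σ
    disjointCycles = record
      { 𝒞 = map orbitOf roots
      ; isDisjointCycles =
          All.map⁺ (All.map (λ a → orbit-cycle (orbit _) (arc-σ^ a)) roots-in-C) , AllPairs.map⁺ disjoint
      ; covers = λ x a → covers (∈-allFin x) a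
      }
      where open OrbitCover (orbitCover moved? (allFin n))

module Assignment {n : ℕ} (E : Fin n → Fin n → Set) (E? : ∀ x y → Dec (E x y)) where

  Feasible : (w : Fin n → Fin n → ℤ) (p q : Fin n → ℤ) → Set
  Feasible w p q = ∀ x y → E x y → w x y ≤ᶻ p x + q y

  record OptimalAssignment (w : Fin n → Fin n → ℤ) : Set where
    field
      σ : Permutation′ n
      σ-in-E : ∀ x → E x (σ ⟨$⟩ʳ x)
      p q : Fin n → ℤ
      feasible : Feasible w p q
      tight : ∀ x → p x + q (σ ⟨$⟩ʳ x) ≡ w x (σ ⟨$⟩ʳ x)

  OptimalAssignment-resp : ∀ {w w′} → (∀ x y → w x y ≡ w′ x y) → OptimalAssignment w → OptimalAssignment w′
  OptimalAssignment-resp w≗w′ O = record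
    { OptimalAssignment O
    ; feasible = λ x y e → subst (_≤ᶻ p x + q y) (w≗w′ x y) (feasible x y e)
    ; tight = λ x → trans (tight x) (w≗w′ x (σ ⟨$⟩ʳ x))
    }
    where open OptimalAssignment O

  -- One phase of the Hungarian method: grow the set Z of rows reachable from s by alternating
  -- tight edges; either a tight edge leads back to s and the alternating path is switched, or
  -- shifting the dual by one on Z removes the deficit at s.
  module Repair {w : Fin n → Fin n → ℤ} (σ : Permutation′ n) (σ-in-E : ∀ x → E x (σ ⟨$⟩ʳ x))
                {p q : Fin n → ℤ} (feasible : Feasible w p q) {s : Fin n} (σs≡s : σ ⟨$⟩ʳ s ≡ s)
                (tight : ∀ x → x ≢ s → p x + q (σ ⟨$⟩ʳ x) ≡ w x (σ ⟨$⟩ʳ x))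
                (slack : p s + q s ≡ sucℤ (w s s)) where

    Tight : Fin n → Fin n → Set
    Tight x y = E x y × p x + q y ≡ w x y

    tight? : ∀ x y → Dec (Tight x y)
    tight? x y = E? x y ×-dec (p x + q y ℤ.≟ w x y)

    record Reroute (Z : Subset n) (z : Fin n) : Set where
      field
        ρ : Permutation′ n
        ρz≡s : ρ ⟨$⟩ʳ z ≡ s
        tight-off-z : ∀ y → y ≢ z → Tight y (ρ ⟨$⟩ʳ y)
        σ-off-Z : ∀ y → y ∉ₛ Z → ρ ⟨$⟩ʳ y ≡ σ ⟨$⟩ʳ y

    Exit : Subset n → Fin n → Fin n → Set
    Exit Z x y = x ∈ₛ Z × Tight x y × (y ≡ s ⊎ σ ⟨$⟩ˡ y ∉ₛ Z)

    exit? : ∀ Z x y → Dec (Exit Z x y)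
    exit? Z x y = (x ∈ₛ? Z) ×-dec tight? x y ×-dec ((y ≟ s) ⊎-dec ¬? (σ ⟨$⟩ˡ y ∈ₛ? Z))

    augment : ∀ {Z x} → Reroute Z x → Tight x s → OptimalAssignment w
    augment {x = x} R t = record
      { σ = ρ ; σ-in-E = proj₁ ∘ tight-ρ ; p = p ; q = q ; feasible = feasible ; tight = proj₂ ∘ tight-ρ }
      where
      open Reroute R
      tight-ρ : ∀ y → Tight y (ρ ⟨$⟩ʳ y)
      tight-ρ y with y ≟ x
      ... | yes refl = subst (Tight y) (sym ρz≡s) t
      ... | no y≢x = tight-off-z y y≢x

    widen : ∀ {Z z} u → Reroute Z z → Reroute (Z ∪ ⁅ u ⁆) z
    widen u R = record { Reroute R ; σ-off-Z = λ y y∉ → σ-off-Z y (proj₁ (x∉p∪⁅y⁆⁻ y∉)) }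
      where open Reroute R

    extend : ∀ {Z x y} → x ∈ₛ Z → Tight x y → σ ⟨$⟩ˡ y ∉ₛ Z → Reroute Z x →
             Reroute (Z ∪ ⁅ σ ⟨$⟩ˡ y ⁆) (σ ⟨$⟩ˡ y)
    extend {Z} {x} {y} x∈Z t u∉Z R = record
      { ρ = transpose x u ∘ₚ ρ
      ; ρz≡s = trans (cong (ρ ⟨$⟩ʳ_) (transpose-matchʳ x u)) ρz≡s
      ; tight-off-z = tight-off-u
      ; σ-off-Z = σ-off-Z′
      }
      where
      open Reroute R
      u : Fin n
      u = σ ⟨$⟩ˡ y
      tight-off-u : ∀ v → v ≢ u → Tight v (ρ ⟨$⟩ʳ (transpose x u ⟨$⟩ʳ v))
      tight-off-u v v≢u = by-cases (v ≟ x)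
        where
        by-cases : Dec (v ≡ x) → Tight v (ρ ⟨$⟩ʳ (transpose x u ⟨$⟩ʳ v))
        by-cases (yes refl) = subst (Tight v) (sym ρx≡y) t
          where
          ρx≡y : ρ ⟨$⟩ʳ (transpose v u ⟨$⟩ʳ v) ≡ y
          ρx≡y = trans (cong (ρ ⟨$⟩ʳ_) (transpose-matchˡ v u)) (trans (σ-off-Z u u∉Z) (inverseʳ σ))
        by-cases (no v≢x) = subst (Tight v) (cong (ρ ⟨$⟩ʳ_) (sym (transpose-other v≢x v≢u))) (tight-off-z v v≢x)
      σ-off-Z′ : ∀ v → v ∉ₛ Z ∪ ⁅ u ⁆ → ρ ⟨$⟩ʳ (transpose x u ⟨$⟩ʳ v) ≡ σ ⟨$⟩ʳ v
      σ-off-Z′ v v∉ = unchanged (x∉p∪⁅y⁆⁻ v∉)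
        where
        unchanged : v ∉ₛ Z × v ≢ u → ρ ⟨$⟩ʳ (transpose x u ⟨$⟩ʳ v) ≡ σ ⟨$⟩ʳ v
        unchanged (v∉Z , v≢u) =
          trans (cong (ρ ⟨$⟩ʳ_) (transpose-other (λ { refl → v∉Z x∈Z }) v≢u)) (σ-off-Z v v∉Z)

    -- By integrality the edges out of Z that are not tight have slack at least 1, and the tight
    -- ones end in σ(Z) ∖ {s}; so lowering p on Z and raising q on σ(Z) ∖ {s} keeps the dual
    -- feasible, while along σ it changes nothing but the deficit at s.
    module Relabel (Z : Subset n) (s∈Z : s ∈ₛ Z) (closed : ∀ x y → ¬ Exit Z x y) where
      open ≡-Reasoning

      Raised : Fin n → Set
      Raised y = y ≢ s × σ ⟨$⟩ˡ y ∈ₛ Z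

      p′ : Fin n → ℤ
      p′ x with x ∈ₛ? Z
      ... | yes _ = pred (p x)
      ... | no _ = p x

      q′ : Fin n → ℤ
      q′ y with ¬? (y ≟ s) ×-dec (σ ⟨$⟩ˡ y ∈ₛ? Z)
      ... | yes _ = sucℤ (q y)
      ... | no _ = q y

      p′-∈ : ∀ {x} → x ∈ₛ Z → p′ x ≡ pred (p x)
      p′-∈ {x} x∈Z with x ∈ₛ? Z
      ... | yes _ = refl
      ... | no x∉Z = contradiction x∈Z x∉Z

      p′-∉ : ∀ {x} → x ∉ₛ Z → p′ x ≡ p x
      p′-∉ {x} x∉Z with x ∈ₛ? Z
      ... | yes x∈Z = contradiction x∈Z x∉Z
      ... | no _ = refl

      q′-raised : ∀ {y} → Raised y → q′ y ≡ sucℤ (q y)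
      q′-raised {y} r with ¬? (y ≟ s) ×-dec (σ ⟨$⟩ˡ y ∈ₛ? Z)
      ... | yes _ = refl
      ... | no ¬r = contradiction r ¬r

      q′-unraised : ∀ {y} → ¬ Raised y → q′ y ≡ q y
      q′-unraised {y} ¬r with ¬? (y ≟ s) ×-dec (σ ⟨$⟩ˡ y ∈ₛ? Z)
      ... | yes r = contradiction r ¬r
      ... | no _ = refl

      q≤q′ : ∀ y → q y ≤ᶻ q′ y
      q≤q′ y with ¬? (y ≟ s) ×-dec (σ ⟨$⟩ˡ y ∈ₛ? Z)
      ... | yes _ = ℤ.i≤suc[i] (q y)
      ... | no _ = ℤ.≤-refl

      tight-raised : ∀ {x y} → x ∈ₛ Z → Tight x y → Raised y
      tight-raised {x} {y} x∈Z t =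
        (λ y≡s → closed x y (x∈Z , t , inj₁ y≡s)) ,
        decidable-stable (σ ⟨$⟩ˡ y ∈ₛ? Z) (λ u∉Z → closed x y (x∈Z , t , inj₂ u∉Z))

      feasible′ : Feasible w p′ q′
      feasible′ x y e with x ∈ₛ? Z
      ... | no x∉Z = ℤ.≤-trans (feasible x y e) (ℤ.+-monoʳ-≤ (p x) (q≤q′ y))
      ... | yes x∈Z with tight? x y
      ...   | yes t = ℤ.≤-reflexive (sym (begin
        pred (p x) + q′ y     ≡⟨ cong (_+_ (pred (p x))) (q′-raised (tight-raised x∈Z t)) ⟩
        pred (p x) + sucℤ (q y) ≡⟨ pred-+-sucℤ (p x) (q y) ⟩
        p x + q y             ≡⟨ proj₂ t ⟩
        w x y                 ∎))
      ...   | no ¬t = ℤ.≤-trans w≤pred (ℤ.+-monoʳ-≤ (pred (p x)) (q≤q′ y))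
        where
        w≤pred : w x y ≤ᶻ pred (p x) + q y
        w≤pred = subst (w x y ≤ᶻ_) (sym (ℤ.pred-+ (p x) (q y)))
                   (ℤ.i<j⇒i≤pred[j] (ℤ.≤∧≢⇒< (feasible x y e) (λ eq → ¬t (e , sym eq))))

      tight-moved : ∀ {x} → x ≢ s → Dec (x ∈ₛ Z) → p′ x + q′ (σ ⟨$⟩ʳ x) ≡ w x (σ ⟨$⟩ʳ x)
      tight-moved {x} x≢s (yes x∈Z) = begin
        p′ x + q′ (σ ⟨$⟩ʳ x)             ≡⟨ cong₂ _+_ (p′-∈ x∈Z) (q′-raised σx-raised) ⟩
        pred (p x) + sucℤ (q (σ ⟨$⟩ʳ x)) ≡⟨ pred-+-sucℤ (p x) (q (σ ⟨$⟩ʳ x)) ⟩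
        p x + q (σ ⟨$⟩ʳ x)               ≡⟨ tight x x≢s ⟩
        w x (σ ⟨$⟩ʳ x)                   ∎
        where
        σx-raised : Raised (σ ⟨$⟩ʳ x)
        σx-raised = (λ σx≡s → x≢s (⟨$⟩ʳ-injective σ (trans σx≡s (sym σs≡s)))) ,
                    subst (_∈ₛ Z) (sym (inverseˡ σ)) x∈Z
      tight-moved {x} x≢s (no x∉Z) = begin
        p′ x + q′ (σ ⟨$⟩ʳ x) ≡⟨ cong₂ _+_ (p′-∉ x∉Z) (q′-unraised σx-unraised) ⟩
        p x + q (σ ⟨$⟩ʳ x)   ≡⟨ tight x x≢s ⟩
        w x (σ ⟨$⟩ʳ x)       ∎
        where
        σx-unraised : ¬ Raised (σ ⟨$⟩ʳ x)
        σx-unraised (_ , x∈Z) = x∉Z (subst (_∈ₛ Z) (inverseˡ σ) x∈Z)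

      tight′ : ∀ x → p′ x + q′ (σ ⟨$⟩ʳ x) ≡ w x (σ ⟨$⟩ʳ x)
      tight′ x with x ≟ s
      ... | yes refl = begin
        p′ x + q′ (σ ⟨$⟩ʳ x)   ≡⟨ cong₂ _+_ (p′-∈ s∈Z) (q′-unraised (λ r → proj₁ r σs≡s)) ⟩
        pred (p x) + q (σ ⟨$⟩ʳ x) ≡⟨ cong (λ t → pred (p x) + q t) σs≡s ⟩
        pred (p x) + q x       ≡⟨ ℤ.pred-+ (p x) (q x) ⟩
        pred (p x + q x)       ≡⟨ cong pred slack ⟩
        pred (sucℤ (w x x))    ≡⟨ ℤ.pred-suc (w x x) ⟩
        w x x                  ≡⟨ cong (w x) (sym σs≡s) ⟩
        w x (σ ⟨$⟩ʳ x)         ∎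
      ... | no x≢s = tight-moved x≢s (x ∈ₛ? Z)

      optimal : OptimalAssignment w
      optimal = record { σ = σ ; σ-in-E = σ-in-E ; p = p′ ; q = q′ ; feasible = feasible′ ; tight = tight′ }

    search : ∀ Z → Acc _⊃_ Z → s ∈ₛ Z → (∀ {z} → z ∈ₛ Z → Reroute Z z) → OptimalAssignment w
    search Z (acc larger) s∈Z reroute with any? (λ x → any? (λ y → exit? Z x y))
    ... | no none = Relabel.optimal Z s∈Z (λ x y ex → none (x , y , ex))
    ... | yes (x , y , x∈Z , t , inj₁ refl) = augment (reroute x∈Z) t
    ... | yes (x , y , x∈Z , t , inj₂ u∉Z) =
      search (Z ∪ ⁅ u ⁆) (larger Z⊂Z∪⁅u⁆) (x∈p∪q⁺ (inj₁ s∈Z)) reroute′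
      where
      u : Fin n
      u = σ ⟨$⟩ˡ y
      Z⊂Z∪⁅u⁆ : Z ⊂ Z ∪ ⁅ u ⁆
      Z⊂Z∪⁅u⁆ = p⊆p∪q ⁅ u ⁆ , u , x∈p∪q⁺ (inj₂ (x∈⁅x⁆ u)) , u∉Z
      reroute′ : ∀ {z} → z ∈ₛ Z ∪ ⁅ u ⁆ → Reroute (Z ∪ ⁅ u ⁆) z
      reroute′ z∈ with x∈p∪q⁻ Z ⁅ u ⁆ z∈
      ... | inj₁ z∈Z = widen u (reroute z∈Z)
      ... | inj₂ z∈⁅u⁆ rewrite x∈⁅y⁆⇒x≡y u z∈⁅u⁆ = extend x∈Z t u∉Z (reroute x∈Z)

    repair : OptimalAssignment w
    repair = search ⁅ s ⁆ (⊃-wellFounded ⁅ s ⁆) (x∈⁅x⁆ s) start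
      where
      start : ∀ {z} → z ∈ₛ ⁅ s ⁆ → Reroute ⁅ s ⁆ z
      start z∈ rewrite x∈⁅y⁆⇒x≡y s z∈ = record
        { ρ = σ ; ρz≡s = σs≡s ; tight-off-z = λ y y≢s → σ-in-E y , tight y y≢s ; σ-off-Z = λ _ _ → refl }

module _ {n : ℕ} (D : Digraph n) where
  open Assignment (ArcOrStay D) (arcOrStay? D)
  open DecMembership (_≟_ {n}) using (_∈?_)

  -- Raising p at s by one absorbs the new weights of row s; tightness at s is lost only when
  -- σ fixes s, and then Repair restores it.
  module RaiseRow {w w′ : Fin n → Fin n → ℤ} (s : Fin n)
                  (other-rows : ∀ x y → x ≢ s → w′ x y ≡ w x y)
                  (on-arc : ∀ y → Arc D s y → w′ s y ≡ sucℤ (w s y))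
                  (off-arc : ∀ y → ¬ Arc D s y → w′ s y ≡ w s y)
                  (O : OptimalAssignment w) where
    open OptimalAssignment O

    p′ : Fin n → ℤ
    p′ x with x ≟ s
    ... | yes _ = sucℤ (p x)
    ... | no _ = p x

    p′-s : p′ s ≡ sucℤ (p s)
    p′-s with s ≟ s
    ... | yes _ = refl
    ... | no s≢s = contradiction refl s≢s

    p′-other : ∀ {x} → x ≢ s → p′ x ≡ p x
    p′-other {x} x≢s with x ≟ s
    ... | yes x≡s = contradiction x≡s x≢s
    ... | no _ = refl

    w′-s≤ : ∀ y → w′ s y ≤ᶻ sucℤ (w s y)
    w′-s≤ y with D s y Bool.≟ true
    ... | yes a = ℤ.≤-reflexive (on-arc y a)
    ... | no ¬a = subst (_≤ᶻ sucℤ (w s y)) (sym (off-arc y ¬a)) (ℤ.i≤suc[i] (w s y))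

    feasible′ : Feasible w′ p′ q
    feasible′ x y e = by-cases (x ≟ s)
      where
      by-cases : Dec (x ≡ s) → w′ x y ≤ᶻ p′ x + q y
      by-cases (no x≢s) =
        subst₂ _≤ᶻ_ (sym (other-rows x y x≢s)) (cong (_+ q y) (sym (p′-other x≢s))) (feasible x y e)
      by-cases (yes refl) = begin
        w′ x y              ≤⟨ w′-s≤ y ⟩
        sucℤ (w x y)        ≤⟨ ℤ.suc-mono (feasible x y e) ⟩
        sucℤ (p x + q y)    ≡⟨ sucℤ-+ (p x) (q y) ⟨
        sucℤ (p x) + q y    ≡⟨ cong (_+ q y) p′-s ⟨
        p′ x + q y          ∎
        where open ℤ.≤-Reasoning

    tight-off-s : ∀ x → x ≢ s → p′ x + q (σ ⟨$⟩ʳ x) ≡ w′ x (σ ⟨$⟩ʳ x)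
    tight-off-s x x≢s = begin
      p′ x + q (σ ⟨$⟩ʳ x) ≡⟨ cong (_+ q (σ ⟨$⟩ʳ x)) (p′-other x≢s) ⟩
      p x + q (σ ⟨$⟩ʳ x)  ≡⟨ tight x ⟩
      w x (σ ⟨$⟩ʳ x)      ≡⟨ other-rows x (σ ⟨$⟩ʳ x) x≢s ⟨
      w′ x (σ ⟨$⟩ʳ x)     ∎
      where open ≡-Reasoning

    s-raised : p′ s + q (σ ⟨$⟩ʳ s) ≡ sucℤ (w s (σ ⟨$⟩ʳ s))
    s-raised = begin
      p′ s + q (σ ⟨$⟩ʳ s)       ≡⟨ cong (_+ q (σ ⟨$⟩ʳ s)) p′-s ⟩
      sucℤ (p s) + q (σ ⟨$⟩ʳ s) ≡⟨ sucℤ-+ (p s) (q (σ ⟨$⟩ʳ s)) ⟩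
      sucℤ (p s + q (σ ⟨$⟩ʳ s)) ≡⟨ cong sucℤ (tight s) ⟩
      sucℤ (w s (σ ⟨$⟩ʳ s))     ∎
      where open ≡-Reasoning

    tight-on-arc : Arc D s (σ ⟨$⟩ʳ s) → ∀ x → p′ x + q (σ ⟨$⟩ʳ x) ≡ w′ x (σ ⟨$⟩ʳ x)
    tight-on-arc a x = by-cases (x ≟ s)
      where
      by-cases : Dec (x ≡ s) → p′ x + q (σ ⟨$⟩ʳ x) ≡ w′ x (σ ⟨$⟩ʳ x)
      by-cases (yes refl) = trans s-raised (sym (on-arc (σ ⟨$⟩ʳ x) a))
      by-cases (no x≢s) = tight-off-s x x≢s

    fixes-s : ¬ Arc D s (σ ⟨$⟩ʳ s) → σ ⟨$⟩ʳ s ≡ s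
    fixes-s ¬a with σ-in-E s
    ... | inj₁ a = contradiction a ¬a
    ... | inj₂ s≡σs = sym s≡σs

    slack-at-s : (¬a : ¬ Arc D s (σ ⟨$⟩ʳ s)) → p′ s + q s ≡ sucℤ (w′ s s)
    slack-at-s ¬a = begin
      p′ s + q s            ≡⟨ cong (λ t → p′ s + q t) (fixes-s ¬a) ⟨
      p′ s + q (σ ⟨$⟩ʳ s)   ≡⟨ s-raised ⟩
      sucℤ (w s (σ ⟨$⟩ʳ s)) ≡⟨ cong (λ t → sucℤ (w s t)) (fixes-s ¬a) ⟩
      sucℤ (w s s)          ≡⟨ cong sucℤ (off-arc s (subst (λ t → ¬ Arc D s t) (fixes-s ¬a) ¬a)) ⟨
      sucℤ (w′ s s)         ∎
      where open ≡-Reasoning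

    raise-row : OptimalAssignment w′
    raise-row with D s (σ ⟨$⟩ʳ s) Bool.≟ true
    ... | yes a = record { OptimalAssignment O ; p = p′ ; feasible = feasible′ ; tight = tight-on-arc a }
    ... | no ¬a = Repair.repair σ σ-in-E {p′} {q} feasible′ (fixes-s ¬a) tight-off-s (slack-at-s ¬a)

  arcWeight : (Fin n → Bool) → Fin n → Fin n → ℤ
  arcWeight r x y = indicator (r x ∧ D x y)

  arcWeight-cong : ∀ r r′ {x} → r x ≡ r′ x → ∀ y → arcWeight r x y ≡ arcWeight r′ x y
  arcWeight-cong r r′ {x} rx≡r′x y = cong (λ b → indicator (b ∧ D x y)) rx≡r′x

  optimal-cong : ∀ {r r′} → (∀ x → r x ≡ r′ x) →
                 OptimalAssignment (arcWeight r) → OptimalAssignment (arcWeight r′)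
  optimal-cong {r} {r′} r≗r′ = OptimalAssignment-resp (λ x → arcWeight-cong r r′ (r≗r′ x))

  optimal-insert : ∀ {r r′ : Fin n → Bool} s → (∀ x → x ≢ s → r x ≡ r′ x) → r s ≡ true → r′ s ≡ false →
                   OptimalAssignment (arcWeight r′) → OptimalAssignment (arcWeight r)
  optimal-insert {r} {r′} s r≡r′ rs r′s = RaiseRow.raise-row s other-rows on-arc off-arc
    where
    other-rows : ∀ x y → x ≢ s → arcWeight r x y ≡ arcWeight r′ x y
    other-rows x y x≢s = arcWeight-cong r r′ (r≡r′ x x≢s) y
    on-arc : ∀ y → Arc D s y → arcWeight r s y ≡ sucℤ (arcWeight r′ s y)
    on-arc y a rewrite rs | r′s | a = refl
    off-arc : ∀ y → ¬ Arc D s y → arcWeight r s y ≡ arcWeight r′ s y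
    off-arc y ¬a rewrite rs | r′s with D s y
    ... | true = contradiction refl ¬a
    ... | false = refl

  member : List (Fin n) → Fin n → Bool
  member L x = does (x ∈? L)

  optimal-list : ∀ (L : List (Fin n)) → OptimalAssignment (arcWeight (member L))
  optimal-list [] = record
    { σ = id ; σ-in-E = λ _ → inj₂ refl ; p = λ _ → 0ℤ ; q = λ _ → 0ℤ
    ; feasible = λ _ _ _ → ℤ.≤-refl ; tight = λ _ → refl }
  optimal-list (s ∷ L) with s ∈? L
  ... | yes s∈L = optimal-cong same (optimal-list L)
    where
    same : ∀ x → member L x ≡ member (s ∷ L) x
    same x = does-⇔ (mk⇔ there λ { (here refl) → s∈L ; (there x∈L) → x∈L }) (x ∈? L) (x ∈? s ∷ L)
  ... | no s∉L =
    optimal-insert s same-off-s (dec-true (s ∈? s ∷ L) (here refl)) (dec-false (s ∈? L) s∉L) (optimal-list L)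
    where
    same-off-s : ∀ x → x ≢ s → member (s ∷ L) x ≡ member L x
    same-off-s x x≢s =
      does-⇔ (mk⇔ (λ { (here x≡s) → contradiction x≡s x≢s ; (there x∈L) → x∈L }) there) (x ∈? s ∷ L) (x ∈? L)

  optimal : ∀ (r : Fin n → Bool) → OptimalAssignment (arcWeight r)
  optimal r = optimal-cong same (optimal-list L)
    where
    L : List (Fin n)
    L = filter (T? ∘ r) (allFin n)
    same : ∀ x → member L x ≡ r x
    same x = does-⇔ (mk⇔ (proj₂ ∘ ∈-filter⁻ (T? ∘ r) {xs = allFin n}) (∈-filter⁺ (T? ∘ r) (∈-allFin x)))
                     (x ∈? L) (T? (r x))

module _ {n : ℕ} (D : Digraph n) (S : Subset n) (φ : Fin n → ℤ) {g} (Good : Fin n → Set g)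
         (φ-mono : ∀ {u v} → Good u → Arc D u v → φ u ≤ᶻ φ v)
         (φ-strict : ∀ {u v} → Good u → u ∈ₛ S → Arc D u v → φ u <ᶻ φ v) where

  φ-walk-≤ : ∀ u us t → Walk D (u ∷ us ++ [ t ]) → All Good (u ∷ us) → φ u ≤ᶻ φ t
  φ-walk-≤ u [] t (a , _) (good ∷ _) = φ-mono good a
  φ-walk-≤ u (v ∷ us) t (a , walk) (good ∷ goods) = ℤ.≤-trans (φ-mono good a) (φ-walk-≤ v us t walk goods)

  φ-walk-< : ∀ u us t → Walk D (u ∷ us ++ [ t ]) → All Good (u ∷ us) → Any (_∈ₛ S) (u ∷ us) → φ u <ᶻ φ t
  φ-walk-< u [] t (a , _) (good ∷ _) (here u∈S) = φ-strict good u∈S a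
  φ-walk-< u (v ∷ us) t (a , walk) (good ∷ goods) (here u∈S) =
    ℤ.<-≤-trans (φ-strict good u∈S a) (φ-walk-≤ v us t walk goods)
  φ-walk-< u (v ∷ us) t (a , walk) (good ∷ goods) (there hit) =
    ℤ.≤-<-trans (φ-mono good a) (φ-walk-< v us t walk goods hit)

  S-cycle-leaves-Good : ∀ c → IsCycle D c → Hits S c → ¬ All Good c
  S-cycle-leaves-Good (v ∷ vs) (_ , walk) hit good = ℤ.<-irrefl refl (φ-walk-< v vs v walk good hit)

module DualCertificate {n : ℕ} (D : Digraph n) (S : Subset n) where
  open Assignment (ArcOrStay D) (arcOrStay? D)
  open OptimalAssignment (optimal D (lookup S)) public

  w : Fin n → Fin n → ℤ
  w = arcWeight D (lookup S)

  X : Subset n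
  X = positive (λ x → p x + q x)

  moved : Subset n
  moved = tabulate (λ x → lookup S x ∧ D x (σ ⟨$⟩ʳ x))

  p+q≥0 : ∀ x → 0ℤ ≤ᶻ p x + q x
  p+q≥0 x = ℤ.≤-trans (indicator≥0 (lookup S x ∧ D x x)) (feasible x x (inj₂ refl))

  q-step : ∀ {u v} → u ∉ₛ X → Arc D u v → w u v + q u ≤ᶻ q v
  q-step {u} {v} u∉X a = begin
    w u v + q u        ≤⟨ ℤ.+-monoˡ-≤ (q u) (feasible u v (inj₁ a)) ⟩
    (p u + q v) + q u  ≡⟨ xy∙z≈xz∙y (p u) (q v) (q u) ⟩
    (p u + q u) + q v  ≡⟨ cong (_+ q v) (∉positive⇒≡0 {f = λ x → p x + q x} (p+q≥0 u) u∉X) ⟩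
    0ℤ + q v           ≡⟨ ℤ.+-identityˡ (q v) ⟩
    q v                ∎
    where open ℤ.≤-Reasoning

  q-mono : ∀ {u v} → u ∉ₛ X → Arc D u v → q u ≤ᶻ q v
  q-mono {u} {v} u∉X a = begin
    q u          ≡⟨ ℤ.+-identityˡ (q u) ⟨
    0ℤ + q u     ≤⟨ ℤ.+-monoˡ-≤ (q u) (indicator≥0 (lookup S u ∧ D u v)) ⟩
    w u v + q u  ≤⟨ q-step u∉X a ⟩
    q v          ∎
    where open ℤ.≤-Reasoning

  q-strict : ∀ {u v} → u ∉ₛ X → u ∈ₛ S → Arc D u v → q u <ᶻ q v
  q-strict {u} {v} u∉X u∈S a = ℤ.suc[i]≤j⇒i<j (subst (λ c → c + q u ≤ᶻ q v) w≡1 (q-step u∉X a))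
    where
    w≡1 : w u v ≡ 1ℤ
    w≡1 rewrite []=⇒lookup u∈S | a = refl

  X-hits : HitsAllSCycles D S X
  X-hits c cycle hit with Any.any? (_∈ₛ? X) c
  ... | yes hitX = hitX
  ... | no ¬hitX =
    contradiction (All.¬Any⇒All¬ c ¬hitX) (S-cycle-leaves-Good D S q (_∉ₛ X) q-mono q-strict c cycle hit)

  ∣X∣≤∣moved∣ : ∣ X ∣ ≤ ∣ moved ∣
  ∣X∣≤∣moved∣ = ℤ.drop‿+≤+ (begin
    + ∣ X ∣                              ≤⟨ ∣positive∣≤sum (λ x → p x + q x) p+q≥0 ⟩
    sum (λ x → p x + q x)                ≡⟨ ∑-distrib-+ p q ⟩
    sum p + sum q                        ≡⟨ cong (_+_ (sum p)) (∑-permute q σ) ⟩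
    sum p + sum (λ x → q (σ ⟨$⟩ʳ x))     ≡⟨ ∑-distrib-+ p (λ x → q (σ ⟨$⟩ʳ x)) ⟨
    sum (λ x → p x + q (σ ⟨$⟩ʳ x))       ≡⟨ sum-cong-≗ tight ⟩
    sum (λ x → w x (σ ⟨$⟩ʳ x))           ≡⟨ ∣tabulate∣≡sum (λ x → lookup S x ∧ D x (σ ⟨$⟩ʳ x)) ⟨
    + ∣ moved ∣                          ∎)
    where open ℤ.≤-Reasoning

theorem2p7 : (n : ℕ) (D : Digraph n) (S : Subset n) →
    Σ (List (List (Fin n))) λ 𝒞 → Σ (Subset n) λ X →
      IsDisjointCycles D 𝒞 × HitsAllSCycles D S X × ∣ X ∣ ≤ ∣ S ∩ V 𝒞 ∣
theorem2p7 n D S =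
  𝒞 , X , isDisjointCycles , X-hits , ℕ.≤-trans ∣X∣≤∣moved∣ (p⊆q⇒∣p∣≤∣q∣ moved⊆S∩V𝒞)
  where
  open DualCertificate D S
  open CycleDecomposition (disjointCycles D {σ} σ-in-E)

  moved⊆S∩V𝒞 : moved ⊆ S ∩ V 𝒞
  moved⊆S∩V𝒞 {x} x∈moved with lookup S x in Sx | ∈-tabulate⁻ x∈moved
  ... | true | arc = x∈p∩q⁺ (lookup⇒[]= x S Sx , ∈V⁺ {𝒞 = 𝒞} (covers x arc))
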